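{- Fix a positive integer $k$. For an integer $n\ge 0$, let $R_k(n)$ denote the number of partitions of $n$ whose Durfee triangle has size $k$. Then, as $n\to\infty$, \[ R_k(n)=\frac{2^k}{k!}\,\frac{n^{k-1}}{(k-1)!}+O(n^{k-2}). \]
   Context: A partition of $n\ge 0$ is a tuple $\lambda=(\lambda_1,\dots,\lambda_d)$ of integers $\lambda_1\ge\cdots\ge\lambda_d\ge 1$ with sum $n$; set $\lambda_j=0$ for $j>d$. The Durfee triangle of $\lambda$ has size $k$ if $k$ is the largest integer such that $\lambda_j>k-j$ for all $j\in\{1,2,\dots,k\}$. -}

module Defs where

open import Data.Nat using (ℕ; zero; suc; _∸_; _≤_; _>_; _≥_)
open import Data.Nat.ListAction using (sum)
open import Relation.Binary.PropositionalEquality using (_≡_)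

open import Data.List using (List; []; _∷_)
open import Data.List.Relation.Unary.All using (All)
open import Data.List.Relation.Unary.Linked using (Linked)
open import Data.List.Relation.Unary.Unique.Propositional using (Unique)
open import Data.List.Membership.Propositional using (_∈_)
open import Data.Product using (_×_)

IsPartition : ℕ → List ℕ → Set
IsPartition n λs = Linked _≥_ λs × All (λ x → 1 ≤ x) λs × sum λs ≡ n

-- λ_j with 1-based index j, and λ_j = 0 for j > d (and for j = 0, unused).
part : List ℕ → ℕ → ℕ
part []       _             = 0
part (x ∷ xs) zero          = 0
part (x ∷ xs) (suc zero)    = x
part (x ∷ xs) (suc (suc j)) = part xs (suc j)

TriangleCond : List ℕ → ℕ → Set
TriangleCond λs k = (j : ℕ) → 1 ≤ j → j ≤ k → part λs j > k ∸ j

DurfeeTriangleSize : List ℕ → ℕ → Set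
DurfeeTriangleSize λs k = TriangleCond λs k × ((m : ℕ) → TriangleCond λs m → m ≤ k)

-- L is an exact (duplicate-free, complete) list of the partitions of n
-- whose Durfee triangle has size k; then R_k(n) = length L.
EnumeratesR : ℕ → ℕ → List (List ℕ) → Set
EnumeratesR k n L =
  Unique L
  × All (λ λs → IsPartition n λs × DurfeeTriangleSize λs k) L
  × ((λs : List ℕ) → IsPartition n λs → DurfeeTriangleSize λs k → λs ∈ L)

-- Let λ have Durfee triangle of size k. Its first a parts are those with λ_j > k + 1 - j (so
-- a ≤ k), and with b = k - a all later parts are at most b. Recording the differences of
-- consecutive parts among the first a, and the multiplicities of the values b, …, 1 among the
-- others, maps λ injectively to a solution of 1 g₁ + ⋯ + a g_a + b e_b + ⋯ + 1 e₁ = n.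
-- Conversely, raising the first a parts by k + 1 and adding one part of each size 1, …, b embeds
-- the solutions for n - O(k²) into these partitions. For k positive weights w including a 1,
-- (k-1)! Π w times the number of solutions lies between n ^ (k-1) and (n + Σ w) ^ (k-1): compare
-- the recursion #(d ∷ ws)(n) = Σ_t #ws(n - d t) with an integral. Here Π w = a! b!, and
-- Σ_a k! / (a! b!) = 2 ^ k.
module Submission where

open import Data.Empty using (⊥; ⊥-elim)
open import Data.List
  using (List; []; _∷_; [_]; _++_; _∷ʳ_; map; length; replicate; take; drop; filter; applyUpTo; applyDownFrom)
open import Data.List.Properties
  using (length-++; length-map; ∷-injective; ∷-injectiveʳ; length-applyUpTo; length-applyDownFrom;
         reverse-applyUpTo; length-take; length-drop; take++drop≡id; map-injective; filter-++; filter-all;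
         filter-none; ++-identityʳ)
open import Data.List.Membership.Propositional using (_∈_)
open import Data.List.Membership.Propositional.Properties using (∈-++⁻; ∈-++⁺ˡ; ∈-++⁺ʳ; ∈-map⁺; ∈-map⁻; ∈-length)
open import Data.List.Relation.Binary.Permutation.Propositional as ↭ using (_↭_)
open import Data.List.Relation.Binary.Permutation.Propositional.Properties
  using (All-resp-↭; ↭-length; ∷↭∷ʳ; ↭-reverse)
open import Data.List.Relation.Binary.Subset.Propositional using (_⊆_)
open import Data.List.Relation.Unary.All using (All; []; _∷_)
import Data.List.Relation.Unary.All as All
import Data.List.Relation.Unary.All.Properties as All
open import Data.List.Relation.Unary.AllPairs using ([]; _∷_)
open import Data.List.Relation.Unary.Any using (here; there; _─_)
open import Data.List.Relation.Unary.Linked using (Linked; []; [-]; _∷_)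
import Data.List.Relation.Unary.Linked as Linked
import Data.List.Relation.Unary.Linked.Properties as Linked
open import Data.List.Relation.Unary.Linked.Properties using (Linked⇒All)
open import Data.List.Relation.Unary.Unique.Propositional using (Unique)
import Data.List.Relation.Unary.Unique.Propositional.Properties as Unique
open import Data.Nat hiding (∣_-_∣)
open import Data.Nat.Combinatorics using (_C_; nCk≡n!/k![n-k]!; k![n∸k]!∣n!; k>n⇒nCk≡0; nCk+nC[k+1]≡[n+1]C[k+1])
open import Data.Nat.DivMod using (m/n*n≡m)
open import Data.Nat.ListAction using (sum; product)
open import Data.Nat.ListAction.Properties using (sum-↭; product-↭; sum-++; product-++)
open import Data.Nat.Properties
open import Data.Nat.Tactic.RingSolver using (solve-∀)
open import Data.Product using (Σ; ∃-syntax; _×_; _,_; proj₁; proj₂)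
import Data.Product as Product
open import Data.Sum using (inj₁; inj₂)
open import Data.Unit using (⊤; tt)
open import Relation.Binary.PropositionalEquality hiding ([_])
open import Relation.Nullary using (¬_; yes; no; contradiction)
open import Algebra.Properties.CommutativeSemigroup +-commutativeSemigroup
  using () renaming (interchange to +-interchange; x∙yz≈y∙xz to +-exchange)
open import Algebra.Properties.CommutativeSemigroup *-commutativeSemigroup
  using () renaming (interchange to *-interchange; x∙yz≈y∙xz to *-exchange)

open import Defs

private variable
  A : Set
  x z : A
  xs ys : List A


length-─ : (p : x ∈ ys) → suc (length (ys ─ p)) ≡ length ys
length-─ (here _)               = refl
length-─ {ys = _ ∷ _} (there p) = cong suc (length-─ p)

∈-─⁺ : (p : x ∈ ys) → z ∈ ys → x ≢ z → z ∈ (ys ─ p)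
∈-─⁺ (here refl) (here refl) x≢z = ⊥-elim (x≢z refl)
∈-─⁺ (here _)    (there q)   _   = q
∈-─⁺ (there p)   (here z≡y)  _   = here z≡y
∈-─⁺ (there p)   (there q)   x≢z = there (∈-─⁺ p q x≢z)

Unique-⊆⇒length≤ : Unique xs → xs ⊆ ys → length xs ≤ length ys
Unique-⊆⇒length≤ {xs = []}     _               _     = z≤n
Unique-⊆⇒length≤ {xs = x ∷ xs} (x∉xs ∷ xs-uniq) xs⊆ys =
  subst (suc (length xs) ≤_) (length-─ x∈ys) (s≤s (Unique-⊆⇒length≤ xs-uniq xs⊆ys─x))
  where
  x∈ys = xs⊆ys (here refl)
  xs⊆ys─x : xs ⊆ (_ ─ x∈ys)
  xs⊆ys─x z∈xs = ∈-─⁺ x∈ys (xs⊆ys (there z∈xs)) (All.lookup x∉xs z∈xs)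

Unique-map⁺ : ∀ {B : Set} (f : A → B) {xs} → (∀ {x y} → x ∈ xs → y ∈ xs → f x ≡ f y → x ≡ y) →
              Unique xs → Unique (map f xs)
Unique-map⁺ f {[]}     _   []              = []
Unique-map⁺ f {x ∷ xs} inj (x∉xs ∷ xs-uniq) =
  All.map⁺ (All.tabulate λ y∈xs fx≡fy → All.lookup x∉xs y∈xs (inj (here refl) (there y∈xs) fx≡fy)) ∷
  Unique-map⁺ f (λ x∈ y∈ → inj (there x∈) (there y∈)) xs-uniq

++-cancel-length : ∀ {xs ys xs′ ys′ : List A} → length xs ≡ length ys → xs ++ xs′ ≡ ys ++ ys′ →
                   xs ≡ ys × xs′ ≡ ys′
++-cancel-length {xs = []}     {[]}     _    eq = refl , eq
++-cancel-length {xs = x ∷ xs} {y ∷ ys} |xs| eq with refl , eq′ ← ∷-injective eq =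
  Product.map₁ (cong (x ∷_)) (++-cancel-length (suc-injective |xs|) eq′)

take-++ : ∀ {n} (xs ys : List A) → length xs ≡ n → take n (xs ++ ys) ≡ xs
take-++ []       ys refl = refl
take-++ (x ∷ xs) ys refl = cong (x ∷_) (take-++ xs ys refl)

drop-++ : ∀ {n} (xs ys : List A) → length xs ≡ n → drop n (xs ++ ys) ≡ ys
drop-++ []       ys refl = refl
drop-++ (x ∷ xs) ys refl = drop-++ xs ys refl

length-take-drop : ∀ a b (v : List A) → length v ≡ a + b → length (take a v) ≡ a × length (drop a v) ≡ b
length-take-drop a b v |v| =
  trans (length-take a v) (trans (cong (a ⊓_) |v|) (m≤n⇒m⊓n≡m (m≤m+n a b))) ,
  trans (length-drop a v) (trans (cong (_∸ a) |v|) (m+n∸m≡n a b))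

sum-replicate : ∀ e x → sum (replicate e x) ≡ x * e
sum-replicate zero    x = sym (*-zeroʳ x)
sum-replicate (suc e) x = trans (cong (x +_) (sum-replicate e x)) (sym (*-suc x e))

sum-map-+ : ∀ c xs → sum (map (c +_) xs) ≡ length xs * c + sum xs
sum-map-+ c []       = refl
sum-map-+ c (x ∷ xs) = trans (cong (c + x +_) (sum-map-+ c xs)) (+-interchange c x (length xs * c) (sum xs))

sum-≤-length* : ∀ {c xs} → All (_≤ c) xs → sum xs ≤ length xs * c
sum-≤-length* []           = z≤n
sum-≤-length* (x≤c ∷ xs≤c) = +-mono-≤ x≤c (sum-≤-length* xs≤c)


sumBelow : ℕ → (ℕ → ℕ) → ℕ
sumBelow zero    f = 0
sumBelow (suc T) f = sumBelow T f + f T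

syntax sumBelow T (λ t → e) = ∑[ t < T ] e

sumBelow-cong : ∀ T {f g : ℕ → ℕ} → (∀ {t} → t < T → f t ≡ g t) → sumBelow T f ≡ sumBelow T g
sumBelow-cong zero    f≗g = refl
sumBelow-cong (suc T) f≗g = cong₂ _+_ (sumBelow-cong T (λ t<T → f≗g (m<n⇒m<1+n t<T))) (f≗g ≤-refl)

sumBelow-mono-≤ : ∀ T {f g : ℕ → ℕ} → (∀ {t} → t < T → f t ≤ g t) → sumBelow T f ≤ sumBelow T g
sumBelow-mono-≤ zero    f≤g = z≤n
sumBelow-mono-≤ (suc T) f≤g = +-mono-≤ (sumBelow-mono-≤ T (λ t<T → f≤g (m<n⇒m<1+n t<T))) (f≤g ≤-refl)

*-distribˡ-sumBelow : ∀ c T (f : ℕ → ℕ) → c * sumBelow T f ≡ ∑[ t < T ] (c * f t)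
*-distribˡ-sumBelow c zero    f = *-zeroʳ c
*-distribˡ-sumBelow c (suc T) f =
  trans (*-distribˡ-+ c (sumBelow T f) (f T)) (cong (_+ c * f T) (*-distribˡ-sumBelow c T f))

sumBelow-+ : ∀ T (f g : ℕ → ℕ) → ∑[ t < T ] (f t + g t) ≡ sumBelow T f + sumBelow T g
sumBelow-+ zero    f g = refl
sumBelow-+ (suc T) f g =
  trans (cong (_+ (f T + g T)) (sumBelow-+ T f g)) (+-interchange (sumBelow T f) _ _ _)

sumBelow-suc : ∀ T (f : ℕ → ℕ) → sumBelow (suc T) f ≡ f 0 + ∑[ t < T ] f (suc t)
sumBelow-suc zero    f = +-comm 0 (f 0)
sumBelow-suc (suc T) f = trans (cong (_+ f (suc T)) (sumBelow-suc T f)) (+-assoc (f 0) _ _)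

sumBelow-telescope-≤ : ∀ (φ F : ℕ → ℕ) → (∀ t → φ t + F (suc t) ≤ F t) →
                       ∀ T → sumBelow T φ + F T ≤ F 0
sumBelow-telescope-≤ φ F step zero    = ≤-refl
sumBelow-telescope-≤ φ F step (suc T) = begin
  sumBelow T φ + φ T + F (suc T)   ≡⟨ +-assoc (sumBelow T φ) (φ T) (F (suc T)) ⟩
  sumBelow T φ + (φ T + F (suc T)) ≤⟨ +-monoʳ-≤ (sumBelow T φ) (step T) ⟩
  sumBelow T φ + F T               ≤⟨ sumBelow-telescope-≤ φ F step T ⟩
  F 0                              ∎
  where open ≤-Reasoning

sumBelow-telescope-≥ : ∀ (φ G : ℕ → ℕ) → (∀ t → G t ≤ φ t + G (suc t)) →
                       ∀ T → G 0 ≤ sumBelow T φ + G T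
sumBelow-telescope-≥ φ G step zero    = ≤-refl
sumBelow-telescope-≥ φ G step (suc T) = begin
  G 0                              ≤⟨ sumBelow-telescope-≥ φ G step T ⟩
  sumBelow T φ + G T               ≤⟨ +-monoʳ-≤ (sumBelow T φ) (step T) ⟩
  sumBelow T φ + (φ T + G (suc T)) ≡⟨ +-assoc (sumBelow T φ) (φ T) (G (suc T)) ⟨
  sumBelow T φ + φ T + G (suc T)   ∎
  where open ≤-Reasoning

concatBelow : ℕ → (ℕ → List A) → List A
concatBelow zero    g = []
concatBelow (suc T) g = concatBelow T g ++ g T

length-concatBelow : ∀ T (g : ℕ → List A) → length (concatBelow T g) ≡ ∑[ t < T ] length (g t)
length-concatBelow zero    g = refl
length-concatBelow (suc T) g =
  trans (length-++ (concatBelow T g)) (cong (_+ length (g T)) (length-concatBelow T g))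

∈-concatBelow⁺ : ∀ {T t} (g : ℕ → List A) → t < T → x ∈ g t → x ∈ concatBelow T g
∈-concatBelow⁺ {T = suc T} g t<1+T x∈gt with m≤n⇒m<n∨m≡n (s≤s⁻¹ t<1+T)
... | inj₁ t<T  = ∈-++⁺ˡ (∈-concatBelow⁺ g t<T x∈gt)
... | inj₂ refl = ∈-++⁺ʳ (concatBelow T g) x∈gt

∈-concatBelow⁻ : ∀ T (g : ℕ → List A) → x ∈ concatBelow T g → ∃[ t ] t < T × x ∈ g t
∈-concatBelow⁻ (suc T) g x∈ with ∈-++⁻ (concatBelow T g) x∈
... | inj₁ x∈init = let t , t<T , x∈gt = ∈-concatBelow⁻ T g x∈init in t , m<n⇒m<1+n t<T , x∈gt
... | inj₂ x∈gT   = T , ≤-refl , x∈gT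

concatBelow-Unique : ∀ T (g : ℕ → List A) → (∀ t → Unique (g t)) →
                     (∀ {s t x} → x ∈ g s → x ∈ g t → s ≡ t) → Unique (concatBelow T g)
concatBelow-Unique zero    g uniq disj = []
concatBelow-Unique (suc T) g uniq disj =
  Unique.++⁺ (concatBelow-Unique T g uniq disj) (uniq T) λ (x∈init , x∈gT) →
    let t , t<T , x∈gt = ∈-concatBelow⁻ T g x∈init in <-irrefl (disj x∈gt x∈gT) t<T


bernoulli : ∀ m x d → suc m * d * x ^ m + x ^ suc m ≤ (x + d) ^ suc m
bernoulli zero    x d = ≤-reflexive (base x d)
  where
  base : ∀ x d → 1 * d * 1 + x * 1 ≡ (x + d) * 1
  base = solve-∀
bernoulli (suc m) x d = begin
  suc (suc m) * d * (x * p) + x * (x * p)                   ≤⟨ m≤m+n _ _ ⟩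
  suc (suc m) * d * (x * p) + x * (x * p) + suc m * d * d * p ≡⟨ expand x d p m ⟩
  (x + d) * (suc m * d * p + x * p)                         ≤⟨ *-monoʳ-≤ (x + d) (bernoulli m x d) ⟩
  (x + d) * (x + d) ^ suc m                                 ∎
  where
  open ≤-Reasoning
  p = x ^ m
  expand : ∀ x d p m → suc (suc m) * d * (x * p) + x * (x * p) + suc m * d * d * p ≡
                       (x + d) * (suc m * d * p + x * p)
  expand = solve-∀

^-suc-≤ : ∀ m x d → (x + d) ^ suc m ≤ suc m * d * (x + d) ^ m + x ^ suc m
^-suc-≤ zero    x d = ≤-reflexive (base x d)
  where
  base : ∀ x d → (x + d) * 1 ≡ 1 * d * 1 + x * 1
  base = solve-∀
^-suc-≤ (suc m) x d = begin
  (x + d) * (x + d) ^ suc m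
    ≤⟨ *-monoʳ-≤ (x + d) (^-suc-≤ m x d) ⟩
  (x + d) * (suc m * d * q + x * p)
    ≡⟨ expand x d p q m ⟩
  suc m * d * ((x + d) * q) + d * (x * p) + x * (x * p)
    ≤⟨ +-monoˡ-≤ (x * (x * p)) (+-monoʳ-≤ (suc m * d * ((x + d) * q)) (*-monoʳ-≤ d x^m+1≤)) ⟩
  suc m * d * ((x + d) * q) + d * ((x + d) * q) + x * (x * p)
    ≡⟨ collect (suc m) d ((x + d) * q) (x * (x * p)) ⟩
  suc (suc m) * d * ((x + d) * q) + x * (x * p) ∎
  where
  open ≤-Reasoning
  p = x ^ m
  q = (x + d) ^ m
  x^m+1≤ : x ^ suc m ≤ (x + d) ^ suc m
  x^m+1≤ = ^-monoˡ-≤ (suc m) (m≤m+n x d)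
  expand : ∀ x d p q m → (x + d) * (suc m * d * q + x * p) ≡
                         suc m * d * ((x + d) * q) + d * (x * p) + x * (x * p)
  expand = solve-∀
  collect : ∀ k d r s → k * d * r + d * r + s ≡ suc k * d * r + s
  collect = solve-∀

^-suc-∸-≤ : ∀ m y d → y ^ suc m ≤ suc m * d * y ^ m + (y ∸ d) ^ suc m
^-suc-∸-≤ m y d with ≤-total d y
... | inj₁ d≤y = subst (λ z → z ^ suc m ≤ suc m * d * z ^ m + (y ∸ d) ^ suc m)
                       (m∸n+n≡m d≤y) (^-suc-≤ m (y ∸ d) d)
... | inj₂ y≤d = begin
  y * y ^ m                           ≤⟨ *-monoˡ-≤ (y ^ m) (≤-trans y≤d (m≤n*m d (suc m))) ⟩
  suc m * d * y ^ m                   ≤⟨ m≤m+n _ _ ⟩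
  suc m * d * y ^ m + (y ∸ d) ^ suc m ∎
  where open ≤-Reasoning

^-distribʳ-* : ∀ m x y → (x * y) ^ m ≡ x ^ m * y ^ m
^-distribʳ-* zero    x y = refl
^-distribʳ-* (suc m) x y = trans (cong (x * y *_) (^-distribʳ-* m x y)) (*-interchange x y (x ^ m) (y ^ m))


-- Sums along arithmetic progressions

strideTerm : ℕ → ℕ → (ℕ → ℕ) → ℕ → ℕ
strideTerm d n g t with d * t ≤? n
... | yes _ = g (n ∸ d * t)
... | no  _ = 0

sumStride : ℕ → ℕ → (ℕ → ℕ) → ℕ
sumStride d n g = ∑[ t < suc n ] strideTerm d n g t

sumStride-cong : ∀ d n {g h : ℕ → ℕ} → (∀ r → g r ≡ h r) → sumStride d n g ≡ sumStride d n h
sumStride-cong d n {g} {h} g≗h = sumBelow-cong (suc n) λ {t} _ → term-cong t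
  where
  term-cong : ∀ t → strideTerm d n g t ≡ strideTerm d n h t
  term-cong t with d * t ≤? n
  ... | yes _ = g≗h (n ∸ d * t)
  ... | no  _ = refl

*-distribˡ-sumStride : ∀ c d n g → c * sumStride d n g ≡ sumStride d n (λ r → c * g r)
*-distribˡ-sumStride c d n g =
  trans (*-distribˡ-sumBelow c (suc n) _) (sumBelow-cong (suc n) λ {t} _ → term t)
  where
  term : ∀ t → c * strideTerm d n g t ≡ strideTerm d n (λ r → c * g r) t
  term t with d * t ≤? n
  ... | yes _ = refl
  ... | no  _ = *-zeroʳ c

-- Compares the sum with the integral of (m + 1) (x + S) ^ m over [0, n + d]: each term is
-- bounded by the increment of F t = (n + S + d - d t) ^ (m + 1) over one step.
sumStride-≤ : ∀ m d S n (g : ℕ → ℕ) → (∀ y → g y ≤ (y + S) ^ m) →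
              suc m * d * sumStride d n g ≤ (n + (d + S)) ^ suc m
sumStride-≤ m d S n g g≤ = begin
  suc m * d * sumStride d n g    ≡⟨ *-distribˡ-sumStride (suc m * d) d n g ⟩
  sumBelow (suc n) φ             ≤⟨ m≤m+n _ _ ⟩
  sumBelow (suc n) φ + F (suc n) ≤⟨ sumBelow-telescope-≤ φ F step (suc n) ⟩
  F 0                            ≡⟨ cong (λ z → (n + S + d ∸ z) ^ suc m) (*-zeroʳ d) ⟩
  (n + S + d) ^ suc m            ≡⟨ cong (_^ suc m) (trans (+-assoc n S d) (cong (n +_) (+-comm S d))) ⟩
  (n + (d + S)) ^ suc m          ∎
  where
  open ≤-Reasoning
  φ = strideTerm d n (λ r → suc m * d * g r)
  F : ℕ → ℕ
  F t = (n + S + d ∸ d * t) ^ suc m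
  step : ∀ t → φ t + F (suc t) ≤ F t
  step t with d * t ≤? n
  ... | no  _    = ^-monoˡ-≤ (suc m) (∸-monoʳ-≤ (n + S + d) (*-monoʳ-≤ d (n≤1+n t)))
  ... | yes dt≤n = begin
    suc m * d * g y + F (suc t)         ≡⟨ cong (λ z → suc m * d * g y + z ^ suc m) base-suc ⟩
    suc m * d * g y + (y + S) ^ suc m   ≤⟨ +-monoˡ-≤ _ (*-monoʳ-≤ (suc m * d) (g≤ y)) ⟩
    suc m * d * (y + S) ^ m + (y + S) ^ suc m ≤⟨ bernoulli m (y + S) d ⟩
    (y + S + d) ^ suc m                 ≡⟨ cong (_^ suc m) base ⟨
    F t                                 ∎
    where
    y = n ∸ d * t
    base : n + S + d ∸ d * t ≡ y + S + d
    base = trans (+-∸-comm d (≤-trans dt≤n (m≤m+n n S))) (cong (_+ d) (+-∸-comm S dt≤n))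
    base-suc : n + S + d ∸ d * suc t ≡ y + S
    base-suc = begin-equality
      n + S + d ∸ d * suc t       ≡⟨ cong (n + S + d ∸_) (trans (*-suc d t) (+-comm d (d * t))) ⟩
      n + S + d ∸ (d * t + d)     ≡⟨ ∸-+-assoc (n + S + d) (d * t) d ⟨
      n + S + d ∸ d * t ∸ d       ≡⟨ cong (_∸ d) base ⟩
      y + S + d ∸ d               ≡⟨ m+n∸n≡m (y + S) d ⟩
      y + S                       ∎

sumStride-≥ : ∀ m d n (g : ℕ → ℕ) → 1 ≤ d → (∀ y → y ^ m ≤ g y) →
              n ^ suc m ≤ suc m * d * sumStride d n g
sumStride-≥ m d n g 1≤d ≤g = begin
  n ^ suc m                      ≡⟨ cong (λ z → (n ∸ z) ^ suc m) (*-zeroʳ d) ⟨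
  G 0                            ≤⟨ sumBelow-telescope-≥ φ G step (suc n) ⟩
  sumBelow (suc n) φ + G (suc n) ≡⟨ cong (λ z → sumBelow (suc n) φ + z ^ suc m) (m≤n⇒m∸n≡0 n≤d[n+1]) ⟩
  sumBelow (suc n) φ + 0         ≡⟨ +-identityʳ _ ⟩
  sumBelow (suc n) φ             ≡⟨ *-distribˡ-sumStride (suc m * d) d n g ⟨
  suc m * d * sumStride d n g    ∎
  where
  open ≤-Reasoning
  φ = strideTerm d n (λ r → suc m * d * g r)
  G : ℕ → ℕ
  G t = (n ∸ d * t) ^ suc m
  n≤d[n+1] : n ≤ d * suc n
  n≤d[n+1] = ≤-trans (n≤1+n n) (m≤n*m (suc n) d {{>-nonZero 1≤d}})
  step : ∀ t → G t ≤ φ t + G (suc t)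
  step t with d * t ≤? n
  ... | no  dt≰n = ≤-trans (≤-reflexive (cong (_^ suc m) (m≤n⇒m∸n≡0 (<⇒≤ (≰⇒> dt≰n))))) z≤n
  ... | yes _    = begin
    y ^ suc m                             ≤⟨ ^-suc-∸-≤ m y d ⟩
    suc m * d * y ^ m + (y ∸ d) ^ suc m   ≤⟨ +-monoˡ-≤ _ (*-monoʳ-≤ (suc m * d) (≤g y)) ⟩
    suc m * d * g y + (y ∸ d) ^ suc m     ≡⟨ cong (λ z → suc m * d * g y + z ^ suc m) next ⟩
    suc m * d * g y + G (suc t)           ∎
    where
    y = n ∸ d * t
    next : y ∸ d ≡ n ∸ d * suc t
    next = trans (∸-+-assoc n (d * t) d) (cong (n ∸_) (trans (+-comm (d * t) d) (sym (*-suc d t))))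


-- Solutions of w₁ x₁ + ⋯ + w_d x_d = n

infixl 7 _·_

_·_ : List ℕ → List ℕ → ℕ
(w ∷ ws) · (x ∷ xs) = w * x + ws · xs
_        · _        = 0

·-zeroʳ : ∀ ws → ws · [] ≡ 0
·-zeroʳ []      = refl
·-zeroʳ (_ ∷ _) = refl

·-++ : ∀ xs ys v → (xs ++ ys) · v ≡ xs · take (length xs) v + ys · drop (length xs) v
·-++ []       ys v       = refl
·-++ (x ∷ xs) ys []      = sym (·-zeroʳ ys)
·-++ (x ∷ xs) ys (t ∷ v) = trans (cong (x * t +_) (·-++ xs ys v)) (sym (+-assoc (x * t) _ _))

·-map-suc : ∀ ws es → length ws ≡ length es → ws · map suc es ≡ ws · es + sum ws
·-map-suc []       []       _    = refl
·-map-suc (w ∷ ws) (e ∷ es) |es| =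
  trans (cong (w * suc e +_) (·-map-suc ws es (suc-injective |es|))) (regroup w e (ws · es) (sum ws))
  where
  regroup : ∀ w e x s → w * suc e + (x + s) ≡ w * e + x + (w + s)
  regroup = solve-∀

-- The first coordinate is searched in 0 … n only, so the list is complete for positive weights.
mutual
  solutions : List ℕ → ℕ → List (List ℕ)
  solutions []       n with n ≟ 0
  ... | yes _ = [ [] ]
  ... | no  _ = []
  solutions (w ∷ ws) n = concatBelow (suc n) (solutionsWithHead w ws n)

  solutionsWithHead : ℕ → List ℕ → ℕ → ℕ → List (List ℕ)
  solutionsWithHead w ws n t with w * t ≤? n
  ... | yes _ = map (t ∷_) (solutions ws (n ∸ w * t))
  ... | no  _ = []

#solutions : List ℕ → ℕ → ℕ
#solutions ws n = length (solutions ws n)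

#solutions-∷ : ∀ w ws n → #solutions (w ∷ ws) n ≡ sumStride w n (#solutions ws)
#solutions-∷ w ws n =
  trans (length-concatBelow (suc n) _) (sumBelow-cong (suc n) λ {t} _ → length-withHead t)
  where
  length-withHead : ∀ t → length (solutionsWithHead w ws n t) ≡ strideTerm w n (#solutions ws) t
  length-withHead t with w * t ≤? n
  ... | yes _ = length-map (t ∷_) (solutions ws (n ∸ w * t))
  ... | no  _ = refl

solutions-sound : ∀ ws n {v} → v ∈ solutions ws n → length v ≡ length ws × ws · v ≡ n
solutions-sound []       n v∈ with n ≟ 0
solutions-sound []       n (here refl) | yes n≡0 = refl , sym n≡0
solutions-sound (w ∷ ws) n v∈ with ∈-concatBelow⁻ (suc n) _ v∈
... | t , _ , v∈t with w * t ≤? n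
... | yes wt≤n with ∈-map⁻ (t ∷_) v∈t
... | u , u∈ , refl with solutions-sound ws (n ∸ w * t) u∈
... | |u| , ws·u = cong suc |u| , trans (cong (w * t +_) ws·u) (m+[n∸m]≡n wt≤n)
solutions-sound (w ∷ ws) n v∈ | t , _ , () | no _

solutions-complete : ∀ {ws v n} → All (1 ≤_) ws → length v ≡ length ws → ws · v ≡ n →
                     v ∈ solutions ws n
solutions-complete {[]}     {[]}    []           _   refl = here refl
solutions-complete {w ∷ ws} {t ∷ v} (1≤w ∷ pos) |v| refl =
  ∈-concatBelow⁺ (solutionsWithHead w ws n) (s≤s (≤-trans (m≤n*m t w {{>-nonZero 1≤w}}) wt≤n)) v∈withHead
  where
  n = w * t + ws · v
  wt≤n = m≤m+n (w * t) (ws · v)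
  v∈rest : v ∈ solutions ws (n ∸ w * t)
  v∈rest = solutions-complete pos (suc-injective |v|) (sym (m+n∸m≡n (w * t) (ws · v)))
  v∈withHead : t ∷ v ∈ solutionsWithHead w ws n t
  v∈withHead with w * t ≤? n
  ... | yes _    = ∈-map⁺ (t ∷_) v∈rest
  ... | no wt≰n = ⊥-elim (wt≰n wt≤n)

solutions-Unique : ∀ ws n → Unique (solutions ws n)
solutions-Unique []       n with n ≟ 0
... | yes _ = [] ∷ []
... | no  _ = []
solutions-Unique (w ∷ ws) n =
  concatBelow-Unique (suc n) (solutionsWithHead w ws n) withHead-Unique heads-equal
  where
  withHead-Unique : ∀ t → Unique (solutionsWithHead w ws n t)
  withHead-Unique t with w * t ≤? n
  ... | yes _ = Unique.map⁺ ∷-injectiveʳ (solutions-Unique ws (n ∸ w * t))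
  ... | no  _ = []
  head-≡ : ∀ {t v} → v ∈ solutionsWithHead w ws n t → ∃[ u ] v ≡ t ∷ u
  head-≡ {t} v∈ with w * t ≤? n
  ... | yes _ = let u , _ , v≡t∷u = ∈-map⁻ (t ∷_) v∈ in u , v≡t∷u
  head-≡ {t} () | no _
  heads-equal : ∀ {s t v} → v ∈ solutionsWithHead w ws n s → v ∈ solutionsWithHead w ws n t → s ≡ t
  heads-equal v∈s v∈t with head-≡ v∈s | head-≡ v∈t
  ... | _ , refl | _ , refl = refl

#solutions-∷-cong : ∀ w {ws ws′} → (∀ r → #solutions ws r ≡ #solutions ws′ r) →
                    ∀ n → #solutions (w ∷ ws) n ≡ #solutions (w ∷ ws′) n
#solutions-∷-cong w {ws} {ws′} ws≗ws′ n = begin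
  #solutions (w ∷ ws) n        ≡⟨ #solutions-∷ w ws n ⟩
  sumStride w n (#solutions ws)  ≡⟨ sumStride-cong w n ws≗ws′ ⟩
  sumStride w n (#solutions ws′) ≡⟨ #solutions-∷ w ws′ n ⟨
  #solutions (w ∷ ws′) n       ∎
  where open ≡-Reasoning

swap₀₁ : List ℕ → List ℕ
swap₀₁ (x ∷ y ∷ v) = y ∷ x ∷ v
swap₀₁ v           = v

swap₀₁-involutive : ∀ v → swap₀₁ (swap₀₁ v) ≡ v
swap₀₁-involutive []          = refl
swap₀₁-involutive (_ ∷ [])     = refl
swap₀₁-involutive (_ ∷ _ ∷ _) = refl

swap₀₁-injective : ∀ {u v} → swap₀₁ u ≡ swap₀₁ v → u ≡ v
swap₀₁-injective {u} {v} eq =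
  trans (sym (swap₀₁-involutive u)) (trans (cong swap₀₁ eq) (swap₀₁-involutive v))

#solutions-swap-≤ : ∀ {x y ws} → All (1 ≤_) (x ∷ y ∷ ws) → ∀ n →
                    #solutions (x ∷ y ∷ ws) n ≤ #solutions (y ∷ x ∷ ws) n
#solutions-swap-≤ {x} {y} {ws} (1≤x ∷ 1≤y ∷ pos) n = begin
  #solutions (x ∷ y ∷ ws) n                       ≡⟨ length-map swap₀₁ (solutions (x ∷ y ∷ ws) n) ⟨
  length (map swap₀₁ (solutions (x ∷ y ∷ ws) n)) ≤⟨ Unique-⊆⇒length≤ swapped-Unique swapped⊆ ⟩
  #solutions (y ∷ x ∷ ws) n                       ∎
  where
  open ≤-Reasoning
  swapped-Unique = Unique.map⁺ swap₀₁-injective (solutions-Unique (x ∷ y ∷ ws) n)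
  swap-solution : ∀ v → length v ≡ length (x ∷ y ∷ ws) × (x ∷ y ∷ ws) · v ≡ n →
                  swap₀₁ v ∈ solutions (y ∷ x ∷ ws) n
  swap-solution (a ∷ b ∷ v) (|v| , refl) =
    solutions-complete (1≤y ∷ 1≤x ∷ pos) |v| (+-exchange (y * b) (x * a) (ws · v))
  swapped⊆ : map swap₀₁ (solutions (x ∷ y ∷ ws) n) ⊆ solutions (y ∷ x ∷ ws) n
  swapped⊆ v∈ with ∈-map⁻ swap₀₁ v∈
  ... | v , v∈′ , refl = swap-solution v (solutions-sound (x ∷ y ∷ ws) n v∈′)

#solutions-↭ : ∀ {ws ws′} → ws ↭ ws′ → All (1 ≤_) ws → ∀ n → #solutions ws n ≡ #solutions ws′ n
#solutions-↭ ↭.refl           _                      n = refl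
#solutions-↭ (↭.prep w p)     (_ ∷ pos)              n = #solutions-∷-cong w (#solutions-↭ p pos) n
#solutions-↭ (↭.swap x y p)   pos@(1≤x ∷ 1≤y ∷ pos′) n =
  trans (≤-antisym (#solutions-swap-≤ pos n) (#solutions-swap-≤ (1≤y ∷ 1≤x ∷ pos′) n))
        (#solutions-∷-cong y (#solutions-∷-cong x (#solutions-↭ p pos′)) n)
#solutions-↭ (↭.trans p q)    pos                    n =
  trans (#solutions-↭ p pos n) (#solutions-↭ q (All-resp-↭ p pos) n)


#solutions-[1] : ∀ n → #solutions [ 1 ] n ≡ 1
#solutions-[1] n = ≤-antisym (Unique-⊆⇒length≤ (solutions-Unique [ 1 ] n) only-[n]) (∈-length [n]∈)
  where
  [n]∈ : [ n ] ∈ solutions [ 1 ] n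
  [n]∈ = solutions-complete (s≤s z≤n ∷ []) refl (trans (+-identityʳ (1 * n)) (*-identityˡ n))
  only-[n] : solutions [ 1 ] n ⊆ [ [ n ] ]
  only-[n] {v} v∈ = singleton v (solutions-sound [ 1 ] n v∈)
    where
    singleton : ∀ v → length v ≡ 1 × [ 1 ] · v ≡ n → v ∈ [ [ n ] ]
    singleton (t ∷ []) (_ , 1·t≡n) =
      here (cong [_] (trans (sym (trans (+-identityʳ (1 * t)) (*-identityˡ t))) 1·t≡n))

scaled-#solutions-∷ : ∀ m d p ws n →
  suc m ! * (d * p) * #solutions (d ∷ ws) n ≡ suc m * d * sumStride d n (λ r → m ! * p * #solutions ws r)
scaled-#solutions-∷ m d p ws n = begin
  suc m ! * (d * p) * #solutions (d ∷ ws) n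
    ≡⟨ cong (suc m ! * (d * p) *_) (#solutions-∷ d ws n) ⟩
  suc m * m ! * (d * p) * sumStride d n (#solutions ws)
    ≡⟨ regroup (suc m) (m !) d p _ ⟩
  suc m * d * (m ! * p * sumStride d n (#solutions ws))
    ≡⟨ cong (suc m * d *_) (*-distribˡ-sumStride (m ! * p) d n _) ⟩
  suc m * d * sumStride d n (λ r → m ! * p * #solutions ws r) ∎
  where
  open ≡-Reasoning
  regroup : ∀ k f d p s → k * f * (d * p) * s ≡ k * d * (f * p * s)
  regroup = solve-∀

-- With the weight 1 last, the recursion on the first weight ends at #solutions [ 1 ] n ≡ 1.
#solutions-∷ʳ1-≥ : ∀ {ds} → All (1 ≤_) ds → ∀ n →
                   n ^ length ds ≤ length ds ! * product ds * #solutions (ds ∷ʳ 1) n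
#solutions-∷ʳ1-≥ []                     n rewrite #solutions-[1] n = ≤-refl
#solutions-∷ʳ1-≥ {d ∷ ds} (1≤d ∷ pos) n = begin
  n ^ suc m
    ≤⟨ sumStride-≥ m d n _ 1≤d (#solutions-∷ʳ1-≥ pos) ⟩
  suc m * d * sumStride d n (λ r → m ! * product ds * #solutions (ds ∷ʳ 1) r)
    ≡⟨ scaled-#solutions-∷ m d (product ds) (ds ∷ʳ 1) n ⟨
  suc m ! * (d * product ds) * #solutions (d ∷ ds ∷ʳ 1) n ∎
  where
  open ≤-Reasoning
  m = length ds

#solutions-∷ʳ1-≤ : ∀ ds n → length ds ! * product ds * #solutions (ds ∷ʳ 1) n ≤ (n + sum ds) ^ length ds
#solutions-∷ʳ1-≤ []       n rewrite #solutions-[1] n = ≤-refl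
#solutions-∷ʳ1-≤ (d ∷ ds) n = begin
  suc m ! * (d * product ds) * #solutions (d ∷ ds ∷ʳ 1) n
    ≡⟨ scaled-#solutions-∷ m d (product ds) (ds ∷ʳ 1) n ⟩
  suc m * d * sumStride d n (λ r → m ! * product ds * #solutions (ds ∷ʳ 1) r)
    ≤⟨ sumStride-≤ m d (sum ds) n _ (#solutions-∷ʳ1-≤ ds) ⟩
  (n + (d + sum ds)) ^ suc m ∎
  where
  open ≤-Reasoning
  m = length ds

↭-∷-─ : ∀ {x} {ws : List ℕ} (x∈ws : x ∈ ws) → ws ↭ x ∷ (ws ─ x∈ws)
↭-∷-─ (here refl)  = ↭.refl
↭-∷-─ (there x∈ws) = ↭.trans (↭.prep _ (↭-∷-─ x∈ws)) (↭.swap _ _ ↭.refl)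

#solutions-bounds : ∀ {ws m} → All (1 ≤_) ws → 1 ∈ ws → length ws ≡ suc m → ∀ n →
                    n ^ m ≤ m ! * product ws * #solutions ws n ×
                    m ! * product ws * #solutions ws n ≤ (n + sum ws) ^ m
#solutions-bounds {ws} pos 1∈ws |ws| n =
  via (↭-∷-─ 1∈ws) (suc-injective (trans (sym |ws|) (↭-length (↭-∷-─ 1∈ws))))
  where
  via : ∀ {ds m} → ws ↭ 1 ∷ ds → m ≡ length ds →
        n ^ m ≤ m ! * product ws * #solutions ws n ×
        m ! * product ws * #solutions ws n ≤ (n + sum ws) ^ m
  via {ds} ρ refl =
    subst (n ^ length ds ≤_) (sym scaled≡) (#solutions-∷ʳ1-≥ (All.tail (All-resp-↭ ρ pos)) n) ,
    subst (_≤ (n + sum ws) ^ length ds) (sym scaled≡)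
      (≤-trans (#solutions-∷ʳ1-≤ ds n) (^-monoˡ-≤ (length ds) (+-monoʳ-≤ n Σds≤Σws)))
    where
    Σds≤Σws : sum ds ≤ sum ws
    Σds≤Σws = ≤-trans (n≤1+n (sum ds)) (≤-reflexive (sym (sum-↭ ρ)))
    scaled≡ : length ds ! * product ws * #solutions ws n ≡ length ds ! * product ds * #solutions (ds ∷ʳ 1) n
    scaled≡ = cong₂ (λ p c → length ds ! * p * c) (trans (product-↭ ρ) (*-identityˡ (product ds)))
                    (#solutions-↭ (↭.trans ρ (∷↭∷ʳ 1 ds)) pos n)


-- Binomial averages

C*factorials≡! : ∀ {k a} → a ≤ k → (k C a) * (a ! * (k ∸ a) !) ≡ k !
C*factorials≡! {k} {a} a≤k =
  trans (cong (_* (a ! * (k ∸ a) !)) (nCk≡n!/k![n-k]! a≤k)) (m/n*n≡m (k![n∸k]!∣n! a≤k))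
  where instance _ = a !* (k ∸ a) !≢0

∑-binomial : ∀ k → ∑[ a < suc k ] (k C a) ≡ 2 ^ k
∑-binomial zero    = refl
∑-binomial (suc k) = begin
  ∑[ a < suc (suc k) ] (suc k C a)
    ≡⟨ sumBelow-suc (suc k) (suc k C_) ⟩
  1 + ∑[ a < suc k ] (suc k C suc a)
    ≡⟨ cong (1 +_) (sumBelow-cong (suc k) λ {a} _ → sym (nCk+nC[k+1]≡[n+1]C[k+1] k a)) ⟩
  1 + ∑[ a < suc k ] (k C a + k C suc a)
    ≡⟨ cong (1 +_) (sumBelow-+ (suc k) (k C_) (λ a → k C suc a)) ⟩
  1 + (∑[ a < suc k ] (k C a) + ∑[ a < suc k ] (k C suc a))
    ≡⟨ +-exchange 1 _ _ ⟩
  ∑[ a < suc k ] (k C a) + (1 + ∑[ a < suc k ] (k C suc a))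
    ≡⟨ cong (∑[ a < suc k ] (k C a) +_) (sumBelow-suc (suc k) (k C_)) ⟨
  ∑[ a < suc k ] (k C a) + ∑[ a < suc (suc k) ] (k C a)
    ≡⟨ cong₂ (λ s z → s + (s + z)) (∑-binomial k) (k>n⇒nCk≡0 (n<1+n k)) ⟩
  2 ^ k + (2 ^ k + 0) ∎
  where open ≡-Reasoning

factorials-as-binomial-sum : ∀ k c (f : ℕ → ℕ) →
  k ! * c * sumBelow (suc k) f ≡ ∑[ a < suc k ] ((k C a) * (c * (a ! * (k ∸ a) !) * f a))
factorials-as-binomial-sum k c f =
  trans (*-distribˡ-sumBelow (k ! * c) (suc k) f) (sumBelow-cong (suc k) λ a<1+k → term (s≤s⁻¹ a<1+k))
  where
  regroup : ∀ b F c x → b * F * c * x ≡ b * (c * F * x)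
  regroup = solve-∀
  term : ∀ {a} → a ≤ k → k ! * c * f a ≡ (k C a) * (c * (a ! * (k ∸ a) !) * f a)
  term {a} a≤k = trans (cong (λ z → z * c * f a) (sym (C*factorials≡! a≤k))) (regroup (k C a) _ c (f a))

power-as-binomial-sum : ∀ k X → 2 ^ k * X ≡ ∑[ a < suc k ] ((k C a) * X)
power-as-binomial-sum k X = begin
  2 ^ k * X                       ≡⟨ cong (_* X) (∑-binomial k) ⟨
  sumBelow (suc k) (k C_) * X     ≡⟨ *-comm _ X ⟩
  X * sumBelow (suc k) (k C_)     ≡⟨ *-distribˡ-sumBelow X (suc k) (k C_) ⟩
  ∑[ a < suc k ] (X * (k C a))    ≡⟨ sumBelow-cong (suc k) (λ {a} _ → *-comm X (k C a)) ⟩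
  ∑[ a < suc k ] ((k C a) * X)    ∎
  where open ≡-Reasoning

binomial-average-≤ : ∀ k c X (f : ℕ → ℕ) → (∀ {a} → a ≤ k → c * (a ! * (k ∸ a) !) * f a ≤ X) →
                     k ! * c * sumBelow (suc k) f ≤ 2 ^ k * X
binomial-average-≤ k c X f bound = begin
  k ! * c * sumBelow (suc k) f
    ≡⟨ factorials-as-binomial-sum k c f ⟩
  ∑[ a < suc k ] ((k C a) * (c * (a ! * (k ∸ a) !) * f a))
    ≤⟨ sumBelow-mono-≤ (suc k) (λ {a} a<1+k → *-monoʳ-≤ (k C a) (bound (s≤s⁻¹ a<1+k))) ⟩
  ∑[ a < suc k ] ((k C a) * X)
    ≡⟨ power-as-binomial-sum k X ⟨
  2 ^ k * X ∎
  where open ≤-Reasoning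

binomial-average-≥ : ∀ k c X (f : ℕ → ℕ) → (∀ {a} → a ≤ k → X ≤ c * (a ! * (k ∸ a) !) * f a) →
                     2 ^ k * X ≤ k ! * c * sumBelow (suc k) f
binomial-average-≥ k c X f bound = begin
  2 ^ k * X
    ≡⟨ power-as-binomial-sum k X ⟩
  ∑[ a < suc k ] ((k C a) * X)
    ≤⟨ sumBelow-mono-≤ (suc k) (λ {a} a<1+k → *-monoʳ-≤ (k C a) (bound (s≤s⁻¹ a<1+k))) ⟩
  ∑[ a < suc k ] ((k C a) * (c * (a ! * (k ∸ a) !) * f a))
    ≡⟨ factorials-as-binomial-sum k c f ⟨
  k ! * c * sumBelow (suc k) f ∎
  where open ≤-Reasoning


-- Durfee triangles

Decreasing : List ℕ → Set
Decreasing = Linked _≥_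

Decreasing-++ : ∀ {c xs ys} → Decreasing xs → Decreasing ys → All (c ≤_) xs → All (_≤ c) ys →
                Decreasing (xs ++ ys)
Decreasing-++ []               dys _           _           = dys
Decreasing-++ {ys = []}    [-] _   _           _           = [-]
Decreasing-++ {ys = _ ∷ _} [-] dys (c≤x ∷ _) (y≤c ∷ _) = ≤-trans y≤c c≤x ∷ dys
Decreasing-++ (x′≤x ∷ dxs)     dys (_ ∷ c≤xs) ys≤c      = x′≤x ∷ Decreasing-++ dxs dys c≤xs ys≤c

Decreasing-++⁻ˡ : ∀ xs {ys} → Decreasing (xs ++ ys) → Decreasing xs
Decreasing-++⁻ˡ []           _            = []
Decreasing-++⁻ˡ (_ ∷ [])     _            = [-]
Decreasing-++⁻ˡ (_ ∷ _ ∷ xs) (y≤x ∷ dec) = y≤x ∷ Decreasing-++⁻ˡ (_ ∷ xs) dec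

Decreasing-++⁻ʳ : ∀ xs {ys} → Decreasing (xs ++ ys) → Decreasing ys
Decreasing-++⁻ʳ []       dec = dec
Decreasing-++⁻ʳ (_ ∷ xs) dec = Decreasing-++⁻ʳ xs (Linked.tail dec)

replicate-decreasing : ∀ e x → Decreasing (replicate e x)
replicate-decreasing zero          x = []
replicate-decreasing (suc zero)    x = [-]
replicate-decreasing (suc (suc e)) x = ≤-refl ∷ replicate-decreasing (suc e) x

Triangle : ℕ → List ℕ → Set
Triangle zero    _        = ⊤
Triangle (suc k) []       = ⊥
Triangle (suc k) (x ∷ xs) = k < x × Triangle k xs

Triangle⇒TriangleCond : ∀ k xs → Triangle k xs → TriangleCond xs k
Triangle⇒TriangleCond (suc k) (x ∷ xs) (k<x , _)   (suc zero)    _ _ = k<x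
Triangle⇒TriangleCond (suc k) (x ∷ xs) (_ , tri) (suc (suc j)) _ (s≤s j<k) =
  Triangle⇒TriangleCond k xs tri (suc j) (s≤s z≤n) j<k

TriangleCond⇒Triangle : ∀ k xs → TriangleCond xs k → Triangle k xs
TriangleCond⇒Triangle zero    xs       _    = tt
TriangleCond⇒Triangle (suc k) []       cond = contradiction (cond 1 ≤-refl (s≤s z≤n)) λ ()
TriangleCond⇒Triangle (suc k) (x ∷ xs) cond =
  cond 1 ≤-refl (s≤s z≤n) ,
  TriangleCond⇒Triangle k xs λ { (suc j) _ j≤k → cond (suc (suc j)) (s≤s z≤n) (s≤s j≤k) }

Triangle-pred : ∀ k {xs} → Triangle (suc k) xs → Triangle k xs
Triangle-pred zero    _                          = tt
Triangle-pred (suc k) {x ∷ xs} (1+k<x , tri) = <-trans (n<1+n k) 1+k<x , Triangle-pred k tri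

Triangle-mono : ∀ {m k xs} → m ≤ k → Triangle k xs → Triangle m xs
Triangle-mono {k = k} m≤k tri with m≤n⇒m<n∨m≡n m≤k
... | inj₂ refl = tri
Triangle-mono {k = suc k} m≤k tri | inj₁ m<1+k = Triangle-mono (s≤s⁻¹ m<1+k) (Triangle-pred k tri)

Triangle-∷ : ∀ c {y ys} → c ≤ y → Triangle c ys → Triangle c (y ∷ ys)
Triangle-∷ zero    _   _   = tt
Triangle-∷ (suc c) c<y tri = c<y , Triangle-pred c tri

Triangle-++ : ∀ c xs {ys} → All (length xs + c ≤_) xs → Triangle c ys → Triangle (length xs + c) (xs ++ ys)
Triangle-++ c []       _              tri = tri
Triangle-++ c (x ∷ xs) (x≥ ∷ xs≥) tri = x≥ , Triangle-++ c xs (All.map (≤-trans (n≤1+n _)) xs≥) tri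

Triangle-++⁻ : ∀ c xs {ys} → Triangle (length xs + c) (xs ++ ys) → Triangle c ys
Triangle-++⁻ c []       tri       = tri
Triangle-++⁻ c (_ ∷ xs) (_ , tri) = Triangle-++⁻ c xs tri

¬Triangle-suc : ∀ {b ys} → All (_≤ b) ys → ¬ Triangle (suc b) ys
¬Triangle-suc {ys = []}    _            ()
¬Triangle-suc {ys = _ ∷ _} (y≤b ∷ _) (b<y , _) = <⇒≱ b<y y≤b

DurfeeTriangleSize⇒¬Triangle : ∀ {xs k} → DurfeeTriangleSize xs k → ¬ Triangle (suc k) xs
DurfeeTriangleSize⇒¬Triangle {xs} {k} (_ , maximal) tri =
  1+n≰n (maximal (suc k) (Triangle⇒TriangleCond (suc k) xs tri))

Triangle⇒DurfeeTriangleSize : ∀ {xs k} → Triangle k xs → ¬ Triangle (suc k) xs → DurfeeTriangleSize xs k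
Triangle⇒DurfeeTriangleSize {xs} {k} tri ¬tri = Triangle⇒TriangleCond k xs tri , maximal
  where
  maximal : ∀ m → TriangleCond xs m → m ≤ k
  maximal m cond with m ≤? k
  ... | yes m≤k = m≤k
  ... | no  m≰k = contradiction (Triangle-mono (≰⇒> m≰k) (TriangleCond⇒Triangle m xs cond)) ¬tri

DurfeeTriangleSize-++ : ∀ {k b large small} → length large + b ≡ k → All (k ≤_) large →
                        Triangle b small → All (_≤ b) small → DurfeeTriangleSize (large ++ small) k
DurfeeTriangleSize-++ {k} {b} {large} {small} |large|+b≡k large≥k tri small≤b =
  Triangle⇒DurfeeTriangleSize triangle ¬triangle
  where
  triangle : Triangle k (large ++ small)
  triangle = subst (λ c → Triangle c (large ++ small)) |large|+b≡k
    (Triangle-++ b large (All.map (≤-trans (≤-reflexive |large|+b≡k)) large≥k) tri)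
  ¬triangle : ¬ Triangle (suc k) (large ++ small)
  ¬triangle tri′ = ¬Triangle-suc small≤b (Triangle-++⁻ (suc b) large
    (subst (λ c → Triangle c (large ++ small)) (sym (trans (+-suc (length large) b) (cong suc |large|+b≡k))) tri′))

-- large is the longest prefix with λ_j > k + 1 - j.
durfee-split : ∀ k {xs} → Decreasing xs → ¬ Triangle (suc k) xs →
               ∃[ a ] a ≤ k × ∃[ large ] ∃[ small ] xs ≡ large ++ small × length large ≡ a × All (_≤ k ∸ a) small
durfee-split k {[]}     _   _    = 0 , z≤n , [] , [] , refl , refl , []
durfee-split k {x ∷ xs} dec ¬tri with x ≤? k
... | yes x≤k = 0 , z≤n , [] , x ∷ xs , refl , refl , Linked⇒All (λ y≤x z≤y → ≤-trans z≤y y≤x) x≤k dec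
durfee-split zero    {x ∷ xs} dec ¬tri | no x≰0 = contradiction (≰⇒> x≰0 , tt) ¬tri
durfee-split (suc k) {x ∷ xs} dec ¬tri | no x≰1+k
  with a , a≤k , large , small , refl , refl , small≤
         ← durfee-split k (Linked.tail dec) (λ tri → ¬tri (≰⇒> x≰1+k , tri)) =
  suc a , s≤s a≤k , x ∷ large , small , refl , refl , small≤


-- Parts from differences and from multiplicities

suffixSums : List ℕ → List ℕ
suffixSums []       = []
suffixSums (g ∷ gs) = g + sum gs ∷ suffixSums gs

differences : List ℕ → List ℕ
differences []           = []
differences (x ∷ [])     = [ x ]
differences (x ∷ y ∷ xs) = x ∸ y ∷ differences (y ∷ xs)

length-suffixSums : ∀ gs → length (suffixSums gs) ≡ length gs
length-suffixSums []       = refl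
length-suffixSums (_ ∷ gs) = cong suc (length-suffixSums gs)

length-differences : ∀ xs → length (differences xs) ≡ length xs
length-differences []           = refl
length-differences (_ ∷ [])     = refl
length-differences (_ ∷ y ∷ xs) = cong suc (length-differences (y ∷ xs))

sum-differences : ∀ {x xs} → Decreasing (x ∷ xs) → sum (differences (x ∷ xs)) ≡ x
sum-differences {x} {[]}    _             = +-identityʳ x
sum-differences {x} {y ∷ _} (y≤x ∷ dec) = trans (cong (x ∸ y +_) (sum-differences dec)) (m∸n+n≡m y≤x)

suffixSums-differences : ∀ {xs} → Decreasing xs → suffixSums (differences xs) ≡ xs
suffixSums-differences {[]}         _             = refl
suffixSums-differences {x ∷ []}     _             = cong [_] (+-identityʳ x)
suffixSums-differences {x ∷ y ∷ xs} (y≤x ∷ dec) =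
  cong₂ _∷_ (trans (cong (x ∸ y +_) (sum-differences dec)) (m∸n+n≡m y≤x)) (suffixSums-differences dec)

differences-suffixSums : ∀ gs → differences (suffixSums gs) ≡ gs
differences-suffixSums []           = refl
differences-suffixSums (g ∷ [])     = cong [_] (+-identityʳ g)
differences-suffixSums (g ∷ h ∷ gs) =
  cong₂ _∷_ (m+n∸n≡m g (h + sum gs)) (differences-suffixSums (h ∷ gs))

suffixSums-decreasing : ∀ gs → Decreasing (suffixSums gs)
suffixSums-decreasing []           = []
suffixSums-decreasing (_ ∷ [])     = [-]
suffixSums-decreasing (g ∷ h ∷ gs) = m≤n+m (h + sum gs) g ∷ suffixSums-decreasing (h ∷ gs)

applyUpTo-suc-· : ∀ (f : ℕ → ℕ) gs →
                  applyUpTo (λ i → suc (f i)) (length gs) · gs ≡ applyUpTo f (length gs) · gs + sum gs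
applyUpTo-suc-· f []       = refl
applyUpTo-suc-· f (g ∷ gs) =
  trans (cong (suc (f 0) * g +_) (applyUpTo-suc-· (λ i → f (suc i)) gs))
        (regroup (f 0 * g) g (applyUpTo (λ i → f (suc i)) (length gs) · gs) (sum gs))
  where
  regroup : ∀ x g y s → g + x + (y + s) ≡ x + y + (g + s)
  regroup = solve-∀

sum-suffixSums : ∀ gs → sum (suffixSums gs) ≡ applyUpTo suc (length gs) · gs
sum-suffixSums []       = refl
sum-suffixSums (g ∷ gs) = begin
  g + sum gs + sum (suffixSums gs)                              ≡⟨ cong (g + sum gs +_) (sum-suffixSums gs) ⟩
  g + sum gs + applyUpTo suc (length gs) · gs                   ≡⟨ regroup g (sum gs) _ ⟩
  1 * g + (applyUpTo suc (length gs) · gs + sum gs)             ≡⟨ cong (1 * g +_) (applyUpTo-suc-· suc gs) ⟨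
  1 * g + applyUpTo (λ i → suc (suc i)) (length gs) · gs        ∎
  where
  open ≡-Reasoning
  regroup : ∀ g s w → g + s + w ≡ 1 * g + (w + s)
  regroup = solve-∀

fromMultiplicities : ℕ → List ℕ → List ℕ
fromMultiplicities zero    _        = []
fromMultiplicities (suc c) []       = []
fromMultiplicities (suc c) (e ∷ es) = replicate e (suc c) ++ fromMultiplicities c es

splitLeading : ℕ → List ℕ → ℕ × List ℕ
splitLeading c []       = 0 , []
splitLeading c (x ∷ xs) with x ≟ c
... | yes _ = Product.map₁ suc (splitLeading c xs)
... | no  _ = 0 , x ∷ xs

multiplicities : ℕ → List ℕ → List ℕ
multiplicities zero    _  = []
multiplicities (suc c) ys = proj₁ (splitLeading (suc c) ys) ∷ multiplicities c (proj₂ (splitLeading (suc c) ys))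

length-multiplicities : ∀ c ys → length (multiplicities c ys) ≡ c
length-multiplicities zero    _  = refl
length-multiplicities (suc c) ys = cong suc (length-multiplicities c _)

replicate-++-splitLeading : ∀ c ys → replicate (proj₁ (splitLeading c ys)) c ++ proj₂ (splitLeading c ys) ≡ ys
replicate-++-splitLeading c []       = refl
replicate-++-splitLeading c (x ∷ xs) with x ≟ c
... | yes refl = cong (x ∷_) (replicate-++-splitLeading c xs)
... | no  _    = refl

splitLeading-replicate-++ : ∀ c e {ys} → All (_≤ c) ys → splitLeading (suc c) (replicate e (suc c) ++ ys) ≡ (e , ys)
splitLeading-replicate-++ c (suc e) ys≤c with suc c ≟ suc c
... | yes _   = cong (Product.map₁ suc) (splitLeading-replicate-++ c e ys≤c)
... | no  c≢c = contradiction refl c≢c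
splitLeading-replicate-++ c zero {[]}     _           = refl
splitLeading-replicate-++ c zero {y ∷ ys} (y≤c ∷ _) with y ≟ suc c
... | yes refl = contradiction y≤c (<-irrefl refl)
... | no  _    = refl

All-splitLeading : ∀ {P : ℕ → Set} c {ys} → All P ys → All P (proj₂ (splitLeading c ys))
All-splitLeading c {[]}     []         = []
All-splitLeading c {x ∷ xs} (px ∷ pxs) with x ≟ c
... | yes _ = All-splitLeading c pxs
... | no  _ = px ∷ pxs

splitLeading-bounded : ∀ c {ys} → Decreasing ys → All (_≤ suc c) ys →
                       Decreasing (proj₂ (splitLeading (suc c) ys)) × All (_≤ c) (proj₂ (splitLeading (suc c) ys))
splitLeading-bounded c {[]}     _   _              = [] , []
splitLeading-bounded c {x ∷ xs} dec (x≤1+c ∷ xs≤) with x ≟ suc c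
... | yes _   = splitLeading-bounded c (Linked.tail dec) xs≤
... | no  x≢ = dec , Linked⇒All (λ y≤x z≤y → ≤-trans z≤y y≤x) (s≤s⁻¹ (≤∧≢⇒< x≤1+c x≢)) dec

fromMultiplicities-bounded : ∀ c es → All (λ y → 1 ≤ y × y ≤ c) (fromMultiplicities c es)
fromMultiplicities-bounded zero    _        = []
fromMultiplicities-bounded (suc c) []       = []
fromMultiplicities-bounded (suc c) (e ∷ es) =
  All.++⁺ (All.replicate⁺ e (s≤s z≤n , ≤-refl))
          (All.map (Product.map₂ m≤n⇒m≤1+n) (fromMultiplicities-bounded c es))

fromMultiplicities-multiplicities : ∀ c {ys} → Decreasing ys → All (1 ≤_) ys → All (_≤ c) ys →
                                    fromMultiplicities c (multiplicities c ys) ≡ ys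
fromMultiplicities-multiplicities zero    {[]}    _   _           _           = refl
fromMultiplicities-multiplicities zero    {_ ∷ _} _   (1≤y ∷ _) (y≤0 ∷ _) = contradiction (≤-trans 1≤y y≤0) λ ()
fromMultiplicities-multiplicities (suc c) {ys}    dec pos         ys≤ =
  trans (cong (replicate e (suc c) ++_) (fromMultiplicities-multiplicities c rest-dec rest-pos rest≤))
        (replicate-++-splitLeading (suc c) ys)
  where
  e = proj₁ (splitLeading (suc c) ys)
  rest-dec = proj₁ (splitLeading-bounded c dec ys≤)
  rest≤ = proj₂ (splitLeading-bounded c dec ys≤)
  rest-pos = All-splitLeading (suc c) pos

multiplicities-fromMultiplicities : ∀ c es → length es ≡ c → multiplicities c (fromMultiplicities c es) ≡ es
multiplicities-fromMultiplicities zero    []       _     = refl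
multiplicities-fromMultiplicities (suc c) (e ∷ es) |es|
  rewrite splitLeading-replicate-++ c e (All.map proj₂ (fromMultiplicities-bounded c es)) =
  cong (e ∷_) (multiplicities-fromMultiplicities c es (suc-injective |es|))

fromMultiplicities-decreasing : ∀ c es → Decreasing (fromMultiplicities c es)
fromMultiplicities-decreasing zero    _        = []
fromMultiplicities-decreasing (suc c) []       = []
fromMultiplicities-decreasing (suc c) (e ∷ es) =
  Decreasing-++ (replicate-decreasing e (suc c)) (fromMultiplicities-decreasing c es)
                (All.replicate⁺ e ≤-refl) (All.map (λ (_ , y≤c) → m≤n⇒m≤1+n y≤c) (fromMultiplicities-bounded c es))

sum-fromMultiplicities : ∀ c es → sum (fromMultiplicities c es) ≡ applyDownFrom suc c · es
sum-fromMultiplicities zero    _        = refl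
sum-fromMultiplicities (suc c) []       = refl
sum-fromMultiplicities (suc c) (e ∷ es) =
  trans (sum-++ (replicate e (suc c)) _) (cong₂ _+_ (sum-replicate e (suc c)) (sum-fromMultiplicities c es))

Triangle-fromMultiplicities-suc : ∀ c es → length es ≡ c → Triangle c (fromMultiplicities c (map suc es))
Triangle-fromMultiplicities-suc zero    _        _     = tt
Triangle-fromMultiplicities-suc (suc c) (e ∷ es) |es| =
  n<1+n c , prepend e (Triangle-fromMultiplicities-suc c es (suc-injective |es|))
  where
  prepend : ∀ e {ys} → Triangle c ys → Triangle c (replicate e (suc c) ++ ys)
  prepend zero    tri = tri
  prepend (suc e) tri = Triangle-∷ c (n≤1+n c) (prepend e tri)


-- weights a b · v ≡ n for v = the differences of the a large parts of a partition of n followed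
-- by the multiplicities of its small parts b, …, 1 (see decode).
weights : ℕ → ℕ → List ℕ
weights a b = applyUpTo suc a ++ applyDownFrom suc b

length-weights : ∀ a b → length (weights a b) ≡ a + b
length-weights a b = trans (length-++ (applyUpTo suc a))
                           (cong₂ _+_ (length-applyUpTo suc a) (length-applyDownFrom suc b))

weights-positive : ∀ a b → All (1 ≤_) (weights a b)
weights-positive a b = All.++⁺ (All.applyUpTo⁺₂ suc a λ _ → s≤s z≤n) (All.applyDownFrom⁺₂ suc b λ _ → s≤s z≤n)

weights-≤ : ∀ a b → All (_≤ a + b) (weights a b)
weights-≤ a b = All.++⁺ (All.applyUpTo⁺₁ suc a λ i<a → ≤-trans i<a (m≤m+n a b))
                        (All.applyDownFrom⁺₁ suc b λ i<b → ≤-trans i<b (m≤n+m b a))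

1∈weights : ∀ a b → 1 ≤ a + b → 1 ∈ weights a b
1∈weights (suc a) b       _ = here refl
1∈weights zero    (suc b) _ = 1∈applyDownFrom b
  where
  1∈applyDownFrom : ∀ b → 1 ∈ applyDownFrom suc (suc b)
  1∈applyDownFrom zero    = here refl
  1∈applyDownFrom (suc b) = there (1∈applyDownFrom b)

product-applyDownFrom-suc : ∀ b → product (applyDownFrom suc b) ≡ b !
product-applyDownFrom-suc zero    = refl
product-applyDownFrom-suc (suc b) = cong (suc b *_) (product-applyDownFrom-suc b)

product-weights : ∀ a b → product (weights a b) ≡ a ! * b !
product-weights a b = begin
  product (applyUpTo suc a ++ applyDownFrom suc b)
    ≡⟨ product-++ (applyUpTo suc a) _ ⟩
  product (applyUpTo suc a) * product (applyDownFrom suc b)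
    ≡⟨ cong (_* _) (product-↭ up↭down) ⟩
  product (applyDownFrom suc a) * product (applyDownFrom suc b)
    ≡⟨ cong₂ _*_ (product-applyDownFrom-suc a) (product-applyDownFrom-suc b) ⟩
  a ! * b ! ∎
  where
  open ≡-Reasoning
  up↭down : applyUpTo suc a ↭ applyDownFrom suc a
  up↭down = subst (applyUpTo suc a ↭_) (reverse-applyUpTo suc a) (↭.↭-sym (↭-reverse (applyUpTo suc a)))

weights-· : ∀ a b v → weights a b · v ≡ applyUpTo suc a · take a v + applyDownFrom suc b · drop a v
weights-· a b v = trans (·-++ (applyUpTo suc a) (applyDownFrom suc b) v)
  (cong (λ l → applyUpTo suc a · take l v + applyDownFrom suc b · drop l v) (length-applyUpTo suc a))

#solutions-weights-bounds : ∀ k a → a ≤ suc k → ∀ n →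
  n ^ k ≤ k ! * (a ! * (suc k ∸ a) !) * #solutions (weights a (suc k ∸ a)) n ×
  k ! * (a ! * (suc k ∸ a) !) * #solutions (weights a (suc k ∸ a)) n ≤ (n + suc k * suc k) ^ k
#solutions-weights-bounds k a a≤1+k n =
  subst (λ p → n ^ k ≤ k ! * p * count) Πws (proj₁ bounds) ,
  subst (λ p → k ! * p * count ≤ (n + suc k * suc k) ^ k) Πws
        (≤-trans (proj₂ bounds) (^-monoˡ-≤ k (+-monoʳ-≤ n Σws≤)))
  where
  b = suc k ∸ a
  a+b≡1+k : a + b ≡ suc k
  a+b≡1+k = m+[n∸m]≡n a≤1+k
  |ws| : length (weights a b) ≡ suc k
  |ws| = trans (length-weights a b) a+b≡1+k
  Σws≤ : sum (weights a b) ≤ suc k * suc k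
  Σws≤ = ≤-trans (sum-≤-length* (weights-≤ a b)) (≤-reflexive (cong₂ _*_ |ws| a+b≡1+k))
  Πws = product-weights a b
  count = #solutions (weights a b) n
  bounds = #solutions-bounds (weights-positive a b) (1∈weights a b (subst (1 ≤_) (sym a+b≡1+k) (s≤s z≤n))) |ws| n


-- Upper bound

decode : ℕ → ℕ → List ℕ → List ℕ
decode a b v = suffixSums (take a v) ++ fromMultiplicities b (drop a v)

weights-·-decode : ∀ a b v → length (take a v) ≡ a → weights a b · v ≡ sum (decode a b v)
weights-·-decode a b v |g| = begin
  weights a b · v
    ≡⟨ weights-· a b v ⟩
  applyUpTo suc a · take a v + applyDownFrom suc b · drop a v
    ≡⟨ cong₂ _+_ g-part (sum-fromMultiplicities b (drop a v)) ⟨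
  sum (suffixSums (take a v)) + sum (fromMultiplicities b (drop a v))
    ≡⟨ sum-++ (suffixSums (take a v)) _ ⟨
  sum (decode a b v) ∎
  where
  open ≡-Reasoning
  g-part : sum (suffixSums (take a v)) ≡ applyUpTo suc a · take a v
  g-part = trans (sum-suffixSums (take a v)) (cong (λ l → applyUpTo suc l · take a v) |g|)

durfee-encode : ∀ k n {xs} → IsPartition n xs → DurfeeTriangleSize xs k →
                ∃[ a ] a ≤ k × ∃[ v ] v ∈ solutions (weights a (k ∸ a)) n × decode a (k ∸ a) v ≡ xs
durfee-encode k n {xs} (dec , pos , Σxs) size
  with a , a≤k , large , small , refl , refl , small≤ ← durfee-split k dec (DurfeeTriangleSize⇒¬Triangle size) =
  a , a≤k , v , v∈ , decode-v
  where
  b = k ∸ a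
  gs = differences large
  |gs| : length gs ≡ a
  |gs| = length-differences large
  v = gs ++ multiplicities b small
  decode-v : decode a b v ≡ large ++ small
  decode-v = cong₂ _++_
    (trans (cong suffixSums (take-++ gs _ |gs|)) (suffixSums-differences (Decreasing-++⁻ˡ large dec)))
    (trans (cong (fromMultiplicities b) (drop-++ gs _ |gs|))
           (fromMultiplicities-multiplicities b (Decreasing-++⁻ʳ large dec) (All.++⁻ʳ large pos) small≤))
  |v| : length v ≡ length (weights a b)
  |v| = trans (length-++ gs) (trans (cong₂ _+_ |gs| (length-multiplicities b small)) (sym (length-weights a b)))
  v∈ : v ∈ solutions (weights a b) n
  v∈ = solutions-complete (weights-positive a b) |v|
         (trans (weights-·-decode a b v (trans (cong length (take-++ gs _ |gs|)) |gs|)) (trans (cong sum decode-v) Σxs))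

#R-≤ : ∀ k n {L} → EnumeratesR k n L → length L ≤ ∑[ a < suc k ] #solutions (weights a (k ∸ a)) n
#R-≤ k n {L} (L-unique , L-valid , _) = begin
  length L
    ≤⟨ Unique-⊆⇒length≤ L-unique L⊆ ⟩
  length decodedAll
    ≡⟨ length-concatBelow (suc k) decoded ⟩
  ∑[ a < suc k ] length (decoded a)
    ≡⟨ sumBelow-cong (suc k) (λ {a} _ → length-map (decode a (k ∸ a)) (solutions (weights a (k ∸ a)) n)) ⟩
  ∑[ a < suc k ] #solutions (weights a (k ∸ a)) n ∎
  where
  open ≤-Reasoning
  decoded : ℕ → List (List ℕ)
  decoded a = map (decode a (k ∸ a)) (solutions (weights a (k ∸ a)) n)
  decodedAll = concatBelow (suc k) decoded
  L⊆ : L ⊆ decodedAll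
  L⊆ xs∈L with (partition , size) ← All.lookup L-valid xs∈L
    with a , a≤k , v , v∈ , refl ← durfee-encode k n partition size =
    ∈-concatBelow⁺ decoded (s≤s a≤k) (∈-map⁺ (decode a (k ∸ a)) v∈)


-- Lower bound

-- Raising the a large parts by k + 1 and adding one part of each size 1, …, b forces the
-- Durfee triangle to have size exactly a + b, at the fixed cost raiseCost k a.
raisedDecode : ℕ → ℕ → ℕ → List ℕ → List ℕ
raisedDecode k a b v = map (suc k +_) (suffixSums (take a v)) ++ fromMultiplicities b (map suc (drop a v))

raiseCost : ℕ → ℕ → ℕ
raiseCost k a = a * suc k + sum (applyDownFrom suc (k ∸ a))

sum-raisedDecode : ∀ k a b v → length v ≡ a + b →
                   sum (raisedDecode k a b v) ≡ a * suc k + sum (applyDownFrom suc b) + weights a b · v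
sum-raisedDecode k a b v |v| = begin
  sum (map (suc k +_) (suffixSums g) ++ fromMultiplicities b (map suc e))
    ≡⟨ sum-++ (map (suc k +_) (suffixSums g)) _ ⟩
  sum (map (suc k +_) (suffixSums g)) + sum (fromMultiplicities b (map suc e))
    ≡⟨ cong₂ _+_ (sum-map-+ (suc k) (suffixSums g)) (sum-fromMultiplicities b (map suc e)) ⟩
  length (suffixSums g) * suc k + sum (suffixSums g) + D · map suc e
    ≡⟨ cong₂ (λ l s → l * suc k + s + D · map suc e) |S| (sum-suffixSums g) ⟩
  a * suc k + applyUpTo suc (length g) · g + D · map suc e
    ≡⟨ cong₂ (λ l x → a * suc k + applyUpTo suc l · g + x) |g| (·-map-suc D e (trans (length-applyDownFrom suc b) (sym |e|))) ⟩
  a * suc k + applyUpTo suc a · g + (D · e + sum D)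
    ≡⟨ regroup (a * suc k) (applyUpTo suc a · g) (D · e) (sum D) ⟩
  a * suc k + sum D + (applyUpTo suc a · g + D · e)
    ≡⟨ cong (a * suc k + sum D +_) (weights-· a b v) ⟨
  a * suc k + sum D + weights a b · v ∎
  where
  open ≡-Reasoning
  g = take a v
  e = drop a v
  D = applyDownFrom suc b
  |g| = proj₁ (length-take-drop a b v |v|)
  |e| = proj₂ (length-take-drop a b v |v|)
  |S| : length (suffixSums g) ≡ a
  |S| = trans (length-suffixSums g) |g|
  regroup : ∀ p q r s → p + q + (r + s) ≡ p + s + (q + r)
  regroup = solve-∀

raisedDecode-valid : ∀ k n a {v} → a ≤ k → raiseCost k a ≤ n → v ∈ solutions (weights a (k ∸ a)) (n ∸ raiseCost k a) →
                     IsPartition n (raisedDecode k a (k ∸ a) v) × DurfeeTriangleSize (raisedDecode k a (k ∸ a) v) k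
raisedDecode-valid k n a {v} a≤k cost≤n v∈ =
  (decreasing , positive , sum≡n) ,
  DurfeeTriangleSize-++ |large|+b≡k (All.map (≤-trans (n≤1+n k)) large>k)
                        (Triangle-fromMultiplicities-suc b e |e|) small≤b
  where
  b = k ∸ a
  g = take a v
  e = drop a v
  large = map (suc k +_) (suffixSums g)
  small = fromMultiplicities b (map suc e)
  sound = solutions-sound (weights a b) (n ∸ raiseCost k a) v∈
  |v| : length v ≡ a + b
  |v| = trans (proj₁ sound) (length-weights a b)
  |e| = proj₂ (length-take-drop a b v |v|)
  |large| : length large ≡ a
  |large| = trans (length-map _ (suffixSums g)) (trans (length-suffixSums g) (proj₁ (length-take-drop a b v |v|)))
  |large|+b≡k : length large + b ≡ k
  |large|+b≡k = trans (cong (_+ b) |large|) (m+[n∸m]≡n a≤k)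
  large>k : All (k <_) large
  large>k = All.map⁺ (All.tabulate λ {x} _ → m≤m+n (suc k) x)
  small-bounded = fromMultiplicities-bounded b (map suc e)
  small≤b : All (_≤ b) small
  small≤b = All.map proj₂ small-bounded
  decreasing : Decreasing (large ++ small)
  decreasing = Decreasing-++ {c = k}
    (Linked.map⁺ (Linked.map (+-monoʳ-≤ (suc k)) (suffixSums-decreasing g)))
    (fromMultiplicities-decreasing b (map suc e))
    (All.map <⇒≤ large>k)
    (All.map (λ y≤b → ≤-trans y≤b (m∸n≤m k a)) small≤b)
  positive : All (1 ≤_) (large ++ small)
  positive = All.++⁺ (All.map (≤-trans (s≤s z≤n)) large>k) (All.map proj₁ small-bounded)
  sum≡n : sum (large ++ small) ≡ n
  sum≡n = trans (sum-raisedDecode k a b v |v|)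
            (trans (cong (raiseCost k a +_) (proj₂ sound)) (m+[n∸m]≡n cost≤n))

raisedDecode-injective : ∀ k a b {v v′} → length v ≡ a + b → length v′ ≡ a + b →
                         raisedDecode k a b v ≡ raisedDecode k a b v′ → v ≡ v′
raisedDecode-injective k a b {v} {v′} |v| |v′| eq = begin
  v                      ≡⟨ take++drop≡id a v ⟨
  take a v ++ drop a v   ≡⟨ cong₂ _++_ g≡g′ e≡e′ ⟩
  take a v′ ++ drop a v′ ≡⟨ take++drop≡id a v′ ⟩
  v′                     ∎
  where
  open ≡-Reasoning
  |large| : ∀ {u} → length u ≡ a + b → length (map (suc k +_) (suffixSums (take a u))) ≡ a
  |large| {u} |u| = trans (length-map (suc k +_) (suffixSums (take a u)))
                          (trans (length-suffixSums (take a u)) (proj₁ (length-take-drop a b u |u|)))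
  |small| : ∀ {u} → length u ≡ a + b → length (map suc (drop a u)) ≡ b
  |small| {u} |u| = trans (length-map suc (drop a u)) (proj₂ (length-take-drop a b u |u|))
  parts = ++-cancel-length (trans (|large| |v|) (sym (|large| |v′|))) eq
  g≡g′ : take a v ≡ take a v′
  g≡g′ = begin
    take a v
      ≡⟨ differences-suffixSums (take a v) ⟨
    differences (suffixSums (take a v))
      ≡⟨ cong differences (map-injective (+-cancelˡ-≡ (suc k) _ _) (proj₁ parts)) ⟩
    differences (suffixSums (take a v′))
      ≡⟨ differences-suffixSums (take a v′) ⟩
    take a v′ ∎
  e≡e′ : drop a v ≡ drop a v′
  e≡e′ = map-injective suc-injective (begin
    map suc (drop a v)
      ≡⟨ multiplicities-fromMultiplicities b _ (|small| |v|) ⟨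
    multiplicities b (fromMultiplicities b (map suc (drop a v)))
      ≡⟨ cong (multiplicities b) (proj₂ parts) ⟩
    multiplicities b (fromMultiplicities b (map suc (drop a v′)))
      ≡⟨ multiplicities-fromMultiplicities b _ (|small| |v′|) ⟩
    map suc (drop a v′) ∎)

#largeParts-raisedDecode : ∀ k a b v → b ≤ k → length (take a v) ≡ a →
                           length (filter (k <?_) (raisedDecode k a b v)) ≡ a
#largeParts-raisedDecode k a b v b≤k |g| = begin
  length (filter (k <?_) (large ++ small))
    ≡⟨ cong length (filter-++ (k <?_) large small) ⟩
  length (filter (k <?_) large ++ filter (k <?_) small)
    ≡⟨ cong₂ (λ xs ys → length (xs ++ ys)) (filter-all (k <?_) large>k) (filter-none (k <?_) small≯k) ⟩
  length (large ++ [])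
    ≡⟨ cong length (++-identityʳ large) ⟩
  length large
    ≡⟨ trans (length-map (suc k +_) (suffixSums (take a v))) (trans (length-suffixSums (take a v)) |g|) ⟩
  a ∎
  where
  open ≡-Reasoning
  large = map (suc k +_) (suffixSums (take a v))
  small = fromMultiplicities b (map suc (drop a v))
  large>k : All (k <_) large
  large>k = All.map⁺ (All.tabulate λ {x} _ → m≤m+n (suc k) x)
  small≯k : All (λ y → ¬ k < y) small
  small≯k = All.map (λ (_ , y≤b) → ≤⇒≯ (≤-trans y≤b b≤k)) (fromMultiplicities-bounded b _)

#R-≥ : ∀ k n {L} → EnumeratesR k n L → (∀ {a} → a ≤ k → raiseCost k a ≤ n) →
       ∑[ a < suc k ] #solutions (weights a (k ∸ a)) (n ∸ raiseCost k a) ≤ length L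
#R-≥ k n {L} (_ , _ , L-complete) cost≤n = begin
  ∑[ a < suc k ] #solutions (weights a (k ∸ a)) (n ∸ raiseCost k a)
    ≡⟨ sumBelow-cong (suc k) (λ {a} _ → length-map _ (sols a)) ⟨
  ∑[ a < suc k ] length (raised a)
    ≡⟨ length-concatBelow (suc k) raised ⟨
  length raisedAll
    ≤⟨ Unique-⊆⇒length≤ raisedAll-Unique raisedAll⊆L ⟩
  length L ∎
  where
  open ≤-Reasoning
  sols : ℕ → List (List ℕ)
  sols a = solutions (weights a (k ∸ a)) (n ∸ raiseCost k a)
  raised : ℕ → List (List ℕ)
  raised a = map (raisedDecode k a (k ∸ a)) (sols a)
  raisedAll = concatBelow (suc k) raised
  |v| : ∀ {a v} → v ∈ sols a → length v ≡ a + (k ∸ a)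
  |v| {a} v∈ = trans (proj₁ (solutions-sound (weights a (k ∸ a)) _ v∈)) (length-weights a (k ∸ a))
  raisedAll⊆L : raisedAll ⊆ L
  raisedAll⊆L xs∈ with a , a<1+k , xs∈a ← ∈-concatBelow⁻ (suc k) raised xs∈
                  with v , v∈ , refl ← ∈-map⁻ (raisedDecode k a (k ∸ a)) xs∈a
                  with partition , size ← raisedDecode-valid k n a (s≤s⁻¹ a<1+k) (cost≤n (s≤s⁻¹ a<1+k)) v∈ =
    L-complete _ partition size
  #large≡ : ∀ {a xs} → xs ∈ raised a → length (filter (k <?_) xs) ≡ a
  #large≡ {a} xs∈ with v , v∈ , refl ← ∈-map⁻ (raisedDecode k a (k ∸ a)) xs∈ =
    #largeParts-raisedDecode k a (k ∸ a) v (m∸n≤m k a) (proj₁ (length-take-drop a (k ∸ a) v (|v| {a} v∈)))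
  raisedAll-Unique : Unique raisedAll
  raisedAll-Unique = concatBelow-Unique (suc k) raised
    (λ a → Unique-map⁺ (raisedDecode k a (k ∸ a))
             (λ v∈ v′∈ → raisedDecode-injective k a (k ∸ a) (|v| {a} v∈) (|v| {a} v′∈))
             (solutions-Unique (weights a (k ∸ a)) _))
    (λ xs∈s xs∈t → trans (sym (#large≡ xs∈s)) (#large≡ xs∈t))


-- The asymptotics

maxRaiseCost : ℕ → ℕ
maxRaiseCost k = k * suc k + k * k

raiseCost≤max : ∀ k a → a ≤ k → raiseCost k a ≤ maxRaiseCost k
raiseCost≤max k a a≤k = +-mono-≤ (*-monoˡ-≤ (suc k) a≤k) (begin
  sum (applyDownFrom suc b)                 ≤⟨ sum-≤-length* (All.applyDownFrom⁺₁ suc b (λ i<b → i<b)) ⟩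
  length (applyDownFrom suc b) * b          ≡⟨ cong (_* b) (length-applyDownFrom suc b) ⟩
  b * b                                     ≤⟨ *-mono-≤ (m∸n≤m k a) (m∸n≤m k a) ⟩
  k * k                                     ∎)
  where
  open ≤-Reasoning
  b = k ∸ a

scaled-#R-≤ : ∀ k n {L} → EnumeratesR (suc k) n L →
              suc k ! * k ! * length L ≤ 2 ^ suc k * (n + suc k * suc k) ^ k
scaled-#R-≤ k n {L} enum = begin
  suc k ! * k ! * length L
    ≤⟨ *-monoʳ-≤ (suc k ! * k !) (#R-≤ (suc k) n enum) ⟩
  suc k ! * k ! * ∑[ a < suc (suc k) ] #solutions (weights a (suc k ∸ a)) n
    ≤⟨ binomial-average-≤ (suc k) (k !) _ _ (λ a≤1+k → proj₂ (#solutions-weights-bounds k _ a≤1+k n)) ⟩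
  2 ^ suc k * (n + suc k * suc k) ^ k ∎
  where open ≤-Reasoning

scaled-#R-≥ : ∀ k n {L} → EnumeratesR (suc k) n L → maxRaiseCost (suc k) ≤ n →
              2 ^ suc k * (n ∸ maxRaiseCost (suc k)) ^ k ≤ suc k ! * k ! * length L
scaled-#R-≥ k n {L} enum max≤n = begin
  2 ^ suc k * (n ∸ maxRaiseCost (suc k)) ^ k
    ≤⟨ binomial-average-≥ (suc k) (k !) _ _ block-≥ ⟩
  suc k ! * k ! * ∑[ a < suc (suc k) ] #solutions (weights a (suc k ∸ a)) (n ∸ raiseCost (suc k) a)
    ≤⟨ *-monoʳ-≤ (suc k ! * k !) (#R-≥ (suc k) n enum λ a≤1+k → ≤-trans (raiseCost≤max (suc k) _ a≤1+k) max≤n) ⟩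
  suc k ! * k ! * length L ∎
  where
  open ≤-Reasoning
  block-≥ : ∀ {a} → a ≤ suc k → (n ∸ maxRaiseCost (suc k)) ^ k ≤
            k ! * (a ! * (suc k ∸ a) !) * #solutions (weights a (suc k ∸ a)) (n ∸ raiseCost (suc k) a)
  block-≥ {a} a≤1+k = ≤-trans (^-monoˡ-≤ k (∸-monoʳ-≤ n (raiseCost≤max (suc k) a a≤1+k)))
                              (proj₁ (#solutions-weights-bounds k a a≤1+k (n ∸ raiseCost (suc k) a)))

n*[n+c]^m-≤ : ∀ m c n → 1 ≤ n → n * (n + c) ^ m ≤ n * n ^ m + suc m * c * suc c ^ m * n ^ m
n*[n+c]^m-≤ m c n 1≤n = begin
  n * (n + c) ^ m
    ≤⟨ *-monoˡ-≤ ((n + c) ^ m) (m≤m+n n c) ⟩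
  (n + c) ^ suc m
    ≤⟨ ^-suc-≤ m n c ⟩
  suc m * c * (n + c) ^ m + n ^ suc m
    ≤⟨ +-monoˡ-≤ (n ^ suc m) (*-monoʳ-≤ (suc m * c) (^-monoˡ-≤ m n+c≤)) ⟩
  suc m * c * (suc c * n) ^ m + n ^ suc m
    ≡⟨ cong (λ z → suc m * c * z + n ^ suc m) (^-distribʳ-* m (suc c) n) ⟩
  suc m * c * (suc c ^ m * n ^ m) + n * n ^ m
    ≡⟨ regroup (suc m * c) (suc c ^ m) (n ^ m) (n * n ^ m) ⟩
  n * n ^ m + suc m * c * suc c ^ m * n ^ m ∎
  where
  open ≤-Reasoning
  n+c≤ : n + c ≤ suc c * n
  n+c≤ = +-monoʳ-≤ n (m≤m*n c n {{>-nonZero 1≤n}})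
  regroup : ∀ a p q r → a * (p * q) + r ≡ r + a * p * q
  regroup = solve-∀

n*n^m-≤ : ∀ m K n → K ≤ n → n * n ^ m ≤ n * (n ∸ K) ^ m + suc m * K * n ^ m
n*n^m-≤ m K n K≤n = begin
  n ^ suc m
    ≤⟨ ^-suc-∸-≤ m n K ⟩
  suc m * K * n ^ m + (n ∸ K) * (n ∸ K) ^ m
    ≤⟨ +-monoʳ-≤ (suc m * K * n ^ m) (*-monoˡ-≤ ((n ∸ K) ^ m) (m∸n≤m n K)) ⟩
  suc m * K * n ^ m + n * (n ∸ K) ^ m
    ≡⟨ +-comm (suc m * K * n ^ m) _ ⟩
  n * (n ∸ K) ^ m + suc m * K * n ^ m ∎
  where open ≤-Reasoning

upperConstant : ℕ → ℕ
upperConstant m = suc m * (suc m * suc m) * suc (suc m * suc m) ^ m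

lowerConstant : ℕ → ℕ
lowerConstant m = suc m * maxRaiseCost (suc m)

*-distribˡ-+-exchange : ∀ t n p c q → t * (n * p + c * q) ≡ n * (t * p) + t * c * q
*-distribˡ-+-exchange = solve-∀

n*scaled-#R-≤ : ∀ m n {L} → EnumeratesR (suc m) n L → 1 ≤ n →
                n * (suc m ! * m ! * length L) ≤ n * (2 ^ suc m * n ^ m) + 2 ^ suc m * upperConstant m * n ^ m
n*scaled-#R-≤ m n {L} enum 1≤n = begin
  n * (suc m ! * m ! * length L)
    ≤⟨ *-monoʳ-≤ n (scaled-#R-≤ m n enum) ⟩
  n * (t * (n + c) ^ m)
    ≡⟨ *-exchange n t _ ⟩
  t * (n * (n + c) ^ m)
    ≤⟨ *-monoʳ-≤ t (n*[n+c]^m-≤ m c n 1≤n) ⟩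
  t * (n * n ^ m + upperConstant m * n ^ m)
    ≡⟨ *-distribˡ-+-exchange t n (n ^ m) (upperConstant m) (n ^ m) ⟩
  n * (t * n ^ m) + t * upperConstant m * n ^ m ∎
  where
  open ≤-Reasoning
  t = 2 ^ suc m
  c = suc m * suc m

n*scaled-#R-≥ : ∀ m n {L} → EnumeratesR (suc m) n L → maxRaiseCost (suc m) ≤ n →
                n * (2 ^ suc m * n ^ m) ≤ n * (suc m ! * m ! * length L) + 2 ^ suc m * lowerConstant m * n ^ m
n*scaled-#R-≥ m n {L} enum K≤n = begin
  n * (t * n ^ m)
    ≡⟨ *-exchange n t _ ⟩
  t * (n * n ^ m)
    ≤⟨ *-monoʳ-≤ t (n*n^m-≤ m K n K≤n) ⟩
  t * (n * (n ∸ K) ^ m + lowerConstant m * n ^ m)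
    ≡⟨ *-distribˡ-+-exchange t n ((n ∸ K) ^ m) (lowerConstant m) (n ^ m) ⟩
  n * (t * (n ∸ K) ^ m) + t * lowerConstant m * n ^ m
    ≤⟨ +-monoˡ-≤ _ (*-monoʳ-≤ n (scaled-#R-≥ m n enum K≤n)) ⟩
  n * (suc m ! * m ! * length L) + t * lowerConstant m * n ^ m ∎
  where
  open ≤-Reasoning
  t = 2 ^ suc m
  K = maxRaiseCost (suc m)

-- Opened only here: ℤ's prefix +_ would make the sections (x +_) above ambiguous.
open import Data.Integer using (+_; ∣_∣; _-_)
open import Data.Integer.Properties using (m-n≡m⊖n; ∣⊖∣-≤; ∣m⊖n∣≡∣n⊖m∣)

n*∣a-b∣≤e : ∀ n a b e → n * a ≤ n * b + e → n * b ≤ n * a + e → n * ∣ + a - + b ∣ ≤ e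
n*∣a-b∣≤e n a b e na≤ nb≤ with ≤-total b a
... | inj₁ b≤a = subst (λ d → n * d ≤ e) (sym ∣a-b∣≡a∸b)
                       (subst (_≤ e) (sym (*-distribˡ-∸ n a b)) (m≤n+o⇒m∸n≤o (n * a) (n * b) na≤))
  where
  ∣a-b∣≡a∸b : ∣ + a - + b ∣ ≡ a ∸ b
  ∣a-b∣≡a∸b = trans (cong ∣_∣ (m-n≡m⊖n a b)) (trans (∣m⊖n∣≡∣n⊖m∣ a b) (∣⊖∣-≤ b≤a))
... | inj₂ a≤b = subst (λ d → n * d ≤ e) (sym ∣a-b∣≡b∸a)
                       (subst (_≤ e) (sym (*-distribˡ-∸ n b a)) (m≤n+o⇒m∸n≤o (n * b) (n * a) nb≤))
  where
  ∣a-b∣≡b∸a : ∣ + a - + b ∣ ≡ b ∸ a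
  ∣a-b∣≡b∸a = trans (cong ∣_∣ (m-n≡m⊖n a b)) (∣⊖∣-≤ a≤b)

theorem2 : (k : ℕ) → 1 ≤ k →
    Σ ℕ λ C → Σ ℕ λ N → (n : ℕ) → n ≥ N → (L : List (List ℕ)) → EnumeratesR k n L →
      n * ∣ + ((k !) * ((k ∸ 1) !) * length L) - + (2 ^ k * n ^ (k ∸ 1)) ∣
        ≤ C * n ^ (k ∸ 1)
theorem2 zero    ()
theorem2 (suc m) _  = 2 ^ suc m * (C₁ + C₂) , suc (maxRaiseCost (suc m)) , estimate
  where
  C₁ = upperConstant m
  C₂ = lowerConstant m
  relax : ∀ {x y c} p → x ≤ y + 2 ^ suc m * c * p → c ≤ C₁ + C₂ → x ≤ y + 2 ^ suc m * (C₁ + C₂) * p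
  relax p x≤ c≤ = ≤-trans x≤ (+-monoʳ-≤ _ (*-monoˡ-≤ p (*-monoʳ-≤ (2 ^ suc m) c≤)))
  estimate : (n : ℕ) → n ≥ suc (maxRaiseCost (suc m)) → (L : List (List ℕ)) → EnumeratesR (suc m) n L →
             n * ∣ + (suc m ! * m ! * length L) - + (2 ^ suc m * n ^ m) ∣ ≤ 2 ^ suc m * (C₁ + C₂) * n ^ m
  estimate n max<n L enum = n*∣a-b∣≤e n _ _ _
    (relax (n ^ m) (n*scaled-#R-≤ m n enum (≤-trans (s≤s z≤n) max<n)) (m≤m+n C₁ C₂))
    (relax (n ^ m) (n*scaled-#R-≥ m n enum (<⇒≤ max<n)) (m≤n+m C₂ C₁))
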